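{- Let $\alpha$ be a composition of $n$, $E\in\mathcal E(\alpha)$ and $T_0=T_{0,E}$ its source tableau. Let $T\in E$ with $T\ne T_0$ and $D(T)\subseteq D(T_0)$, define $i=\max\{k\in[n]:T^{ -1}(k)\ne T_0^{ -1}(k)\}$ and $j=\min\{k\in[n]: k>i\text{ and } i\text{ attacks }k\text{ in }T_0\}$, and set $\sigma=s_{j-1}\cdots s_{i+1}s_i\in\mathfrak S_n$. Then (1) $\pi_\sigma T_0=0$; (2) $\pi_\sigma T\in E$; (3) $\sigma=\mathrm{col}_{\pi_\sigma T}\mathrm{col}_T^{ -1}$.
   Context: $\mathfrak S_n$ is the symmetric group on $[n]$, $s_i=(i,i+1)$, products are composition of functions. $H_n(0)$ is generated by $\pi_1,\dots,\pi_{n-1}$ with $\pi_i^2=\pi_i$, $\pi_i\pi_{i+1}\pi_i=\pi_{i+1}\pi_i\pi_{i+1}$, $\pi_i\pi_j=\pi_j\pi_i$ ($|i-j|\ge2$); for $\sigma$ with a reduced (minimal length) word $s_{j_k}\cdots s_{j_1}$, $\pi_\sigma=\pi_{j_k}\cdots\pi_{j_1}$ (well defined). A composition $\alpha=(\alpha_1,\dots,\alpha_l)$ of $n$ has diagram $\{(i,j):i\le l,j\le\alpha_i\}$ (matrix coordinates, row 1 on top). An SCT of shape $\alpha$ is a bijection $T$ from the diagram to $[n]$ with rows decreasing left to right, first column increasing top to bottom, and the triple rule: if $(j,k),(i,k-1)\in\alpha$, $j>i$, $T(j,k)<T(i,k-1)$, then $(i,k)\in\alpha$ and $T(j,k)<T(i,k)$.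 Let $c_T(k)$ be the column of $T^{ -1}(k)$. A cell $(i,j)$ attacks $(i',j')$ if $j=j'$ and $i\ne i'$, or $j=j'-1$ and $i<i'$; entry $a$ attacks $b$ in $T$ if $T^{ -1}(a)$ attacks $T^{ -1}(b)$. $D(T)=\{i\in[n-1]:c_T(i)\le c_T(i+1)\}$, $AD(T)=\{i\in D(T): i\text{ attacks }i+1\}$, $nAD(T)=D(T)\setminus AD(T)$. $H_n(0)$ acts on the $\mathbb C$-span of the SCTs of shape $\alpha$ by $\pi_iT=T$ if $i\notin D(T)$, $0$ if $i\in AD(T)$, and $T$ with entries $i,i+1$ interchanged if $i\in nAD(T)$. $T_1\sim T_2$ iff in each column the relative orders of entries coincide; $\mathcal E(\alpha)$ is the set of equivalence classes. The source tableau $T_{0,E}$ is the unique $T\in E$ such that for every $i\in[n-1]\setminus D(T)$ the cell of $i+1$ is immediately to the left of the cell of $i$ in the same row. The column word $\mathrm{col}_T\in\mathfrak S_n$ reads the columns of $T$ left to right, each from top to bottom, as a permutation in one-line notation. -}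

module Defs where

open import Data.Nat using (ℕ; zero; suc; _+_; _∸_; _≤_; _<_; _⊔_)
open import Data.Nat.Properties using (_≟_; _≤?_; _<?_)
open import Data.Nat.ListAction using (sum)
open import Data.List using (List; []; _∷_; map; concat; length; upTo; foldr; mapMaybe)
open import Data.List.Relation.Unary.All using (All)
open import Data.List.Relation.Binary.Permutation.Propositional using (_↭_)
open import Data.Maybe using (Maybe; just; nothing; _>>=_; maybe′)
import Data.Maybe as Maybe
open import Data.Product using (_×_; _,_; proj₁; proj₂; ∃)
open import Data.Sum using (_⊎_)
open import Data.Bool using (Bool; true; false; if_then_else_)
open import Relation.Nullary using (Dec; does; ¬_)
open import Relation.Nullary.Decidable using (_×-dec_; _⊎-dec_; ¬?)
open import Relation.Binary.PropositionalEquality using (_≡_; _≢_)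
open import Function.Bundles using (_⇔_)

-- A filling of a composition diagram: the list of its rows (row 1 first),
-- each row listed left to right.  Cells are 0-indexed (row , column).
Tableau : Set
Tableau = List (List ℕ)

nth : {A : Set} → List A → ℕ → Maybe A
nth [] _ = nothing
nth (x ∷ xs) zero = just x
nth (x ∷ xs) (suc k) = nth xs k

IsComposition : ℕ → List ℕ → Set
IsComposition n α = All (λ a → 0 < a) α × sum α ≡ n

rowLen : List ℕ → ℕ → ℕ
rowLen α r = maybe′ (λ a → a) 0 (nth α r)

InShape : List ℕ → ℕ → ℕ → Set
InShape α r c = c < rowLen α r

-- entry of T in cell (r , c)  (0 outside the diagram)
ent : Tableau → ℕ → ℕ → ℕ
ent T r c = maybe′ (λ row → maybe′ (λ x → x) 0 (nth row c)) 0 (nth T r)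

record IsSCT (n : ℕ) (α : List ℕ) (T : Tableau) : Set where
  field
    shape   : map length T ≡ α
    bij     : concat T ↭ map suc (upTo n)
    rowDec  : ∀ r c → InShape α r (suc c) → ent T r (suc c) < ent T r c
    col1Inc : ∀ r → suc r < length α → ent T r 0 < ent T (suc r) 0
    triple  : ∀ i j k → i < j → InShape α j (suc k) → InShape α i k →
              ent T j (suc k) < ent T i k →
              InShape α i (suc k) × ent T j (suc k) < ent T i (suc k)

findInRow : List ℕ → ℕ → Maybe ℕ
findInRow [] k = nothing
findInRow (x ∷ xs) k = if does (x ≟ k) then just 0 else Maybe.map suc (findInRow xs k)

findPos : Tableau → ℕ → Maybe (ℕ × ℕ)
findPos [] k = nothing
findPos (row ∷ T) k with findInRow row k
... | just c = just (0 , c)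
... | nothing = Maybe.map (λ p → suc (proj₁ p) , proj₂ p) (findPos T k)

-- total version (default (0,0) is never used for entries of an SCT)
pos : Tableau → ℕ → ℕ × ℕ
pos T k = maybe′ (λ p → p) (0 , 0) (findPos T k)

col : Tableau → ℕ → ℕ
col T k = proj₂ (pos T k)

Attacks : ℕ × ℕ → ℕ × ℕ → Set
Attacks (r , c) (r' , c') = (c ≡ c' × r ≢ r') ⊎ (suc c ≡ c' × r < r')

attacks? : (p q : ℕ × ℕ) → Dec (Attacks p q)
attacks? (r , c) (r' , c') =
  ((c ≟ c') ×-dec ¬? (r ≟ r')) ⊎-dec ((suc c ≟ c') ×-dec (r <? r'))

AttacksIn : Tableau → ℕ → ℕ → Set
AttacksIn T a b = Attacks (pos T a) (pos T b)

-- the descent condition c_T(k) ≤ c_T(k+1)  (k ∈ D(T) when moreover 1 ≤ k < n)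
InD : Tableau → ℕ → Set
InD T k = col T k ≤ col T (suc k)

swapEntry : ℕ → ℕ → ℕ
swapEntry a x = if does (x ≟ a) then suc a else (if does (x ≟ suc a) then a else x)

swapT : ℕ → Tableau → Tableau
swapT a T = map (map (swapEntry a)) T

-- action of π_a on a basis tableau; nothing represents 0
piAct : ℕ → Tableau → Maybe Tableau
piAct a T =
  if does (col T a ≤? col T (suc a))
  then (if does (attacks? (pos T a) (pos T (suc a))) then nothing else just (swapT a T))
  else just T

-- a word listed in order of application: [a₁, …, a_k] stands for s_{a_k} ⋯ s_{a₁}
-- π_{a_k} ⋯ π_{a₁} applied to a basis element or 0
piWord : List ℕ → Maybe Tableau → Maybe Tableau
piWord [] m = m
piWord (a ∷ w) m = piWord w (m >>= piAct a)

applyWord : List ℕ → ℕ → ℕ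
applyWord [] x = x
applyWord (a ∷ w) x = applyWord w (swapEntry a x)

-- [i, i+1, …, j-1], i.e. the (reduced) word s_{j-1} ⋯ s_{i+1} s_i
cycWord : ℕ → ℕ → List ℕ
cycWord i j = map (i +_) (upTo (j ∸ i))

Equiv : List ℕ → Tableau → Tableau → Set
Equiv α T T' = ∀ r r' c → InShape α r c → InShape α r' c →
  (ent T r c < ent T r' c ⇔ ent T' r c < ent T' r' c)

IsSource : ℕ → Tableau → Set
IsSource n T = ∀ k → 1 ≤ k → k < n → ¬ InD T k →
  proj₁ (pos T (suc k)) ≡ proj₁ (pos T k) × suc (col T (suc k)) ≡ col T k

column : Tableau → ℕ → List ℕ
column T c = mapMaybe (λ row → nth row c) T

colWord : Tableau → List ℕ
colWord T = concat (map (column T) (upTo (foldr _⊔_ 0 (map length T))))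

module Submission where

-- Let p and q be the cells of i in T₀ and in T.  As T and T₀ agree on all entries
-- above i and order every column alike, T₀(q) < i and T(p) < i, and walking from
-- T₀(q) up to i with the source property gives col q < col p.  Walking on from i
-- to j (nothing in between is attacked by i) every such entry of T₀ lies strictly
-- right of p, and the triple rule keeps j out of the column right of q below q.
-- So in T₀ the entry i slides through i+1, …, j-1 by non-attacking descents until
-- π_{j-1} kills it, while in T the entry i attacks none of i+1, …, j, so π_σ T is
-- T relabelled by σ.  The relabelling preserves the relative order of two entries
-- unless they are i and some m ∈ (i, j], and such pairs never share a column, a row
-- or a triple, so σ T is again an SCT in the class of T₀.

open import Defs
open import Data.Nat using (ℕ; zero; suc; _+_; _∸_; _≤_; _<_; _⊔_; _≡ᵇ_; z≤n; s≤s)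
open import Data.Nat.Properties
open import Data.Bool using (true; false)
open import Data.Empty using (⊥-elim)
open import Data.List using (List; []; _∷_; _++_; map; concat; length; foldr; upTo; applyUpTo)
open import Data.List.Properties using (map-∘; map-cong; map-id; concat-map; length-map; map-upTo)
open import Data.List.Membership.Propositional using (_∈_)
open import Data.List.Membership.Propositional.Properties
  using (∈-++⁺ˡ; ∈-++⁺ʳ; ∈-++⁻; ∈-map⁺; ∈-map⁻; ∈-upTo⁺; ∈-upTo⁻)
open import Data.List.Membership.Propositional.Properties.WithK using (unique∧set⇒bag)
open import Data.List.Relation.Binary.BagAndSetEquality using (∼bag⇒↭)
open import Data.List.Relation.Binary.Permutation.Propositional
  using (_↭_; ↭-sym; ↭-reflexive; ↭⇒↭ₛ; module PermutationReasoning)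
import Data.List.Relation.Binary.Permutation.Propositional.Properties as ↭
open import Data.List.Relation.Unary.All as All using (All; []; _∷_)
import Data.List.Relation.Unary.All.Properties as All
open import Data.List.Relation.Unary.AllPairs using ([]; _∷_)
open import Data.List.Relation.Unary.Any using (here; there)
open import Data.List.Relation.Unary.Unique.Propositional using (Unique)
import Data.List.Relation.Unary.Unique.Propositional.Properties as Unique
open import Data.Maybe using (just; nothing; maybe′)
import Data.Maybe as Maybe
open import Data.Product using (_×_; _,_; proj₁; proj₂; ∃)
open import Data.Product.Properties using (≡-dec)
open import Data.Sum using (inj₁; inj₂)
open import Function using (id; _∘_)
open import Function.Bundles using (_⇔_; mk⇔; Equivalence)
open import Relation.Nullary using (yes; no; proof; ofʸ; ofⁿ; ¬_)
open import Relation.Nullary.Decidable using (does-⇔; dec-true; dec-false)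
open import Relation.Binary.Definitions using (tri<; tri≈; tri>)
open import Relation.Binary.PropositionalEquality
open import Data.List.Relation.Binary.Permutation.Setoid.Properties (setoid ℕ) using (Unique-resp-↭)

open Equivalence using (to; from)

-- Reading entries and positions

rowAt : Tableau → ℕ → List ℕ
rowAt U r = maybe′ id [] (nth U r)

rowEntry : List ℕ → ℕ → ℕ
rowEntry row c = maybe′ id 0 (nth row c)

ent-rowAt : ∀ U r c → ent U r c ≡ rowEntry (rowAt U r) c
ent-rowAt U r c with nth U r
... | just _ = refl
... | nothing = refl

nth-map : ∀ {A B : Set} (f : A → B) xs r → nth (map f xs) r ≡ Maybe.map f (nth xs r)
nth-map f [] r = refl
nth-map f (x ∷ xs) zero = refl
nth-map f (x ∷ xs) (suc r) = nth-map f xs r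

rowEntry-∈ : ∀ row c → c < length row → rowEntry row c ∈ row
rowEntry-∈ (x ∷ row) zero _ = here refl
rowEntry-∈ (x ∷ row) (suc c) (s≤s c<) = there (rowEntry-∈ row c c<)

ent-∈-concat : ∀ U r c → InShape (map length U) r c → ent U r c ∈ concat U
ent-∈-concat (row ∷ U) zero c c< = ∈-++⁺ˡ (rowEntry-∈ row c c<)
ent-∈-concat (row ∷ U) (suc r) c c< = ∈-++⁺ʳ row (ent-∈-concat U r c c<)

Unique-++⁻ : ∀ {A : Set} (xs : List A) {ys : List A} → Unique (xs ++ ys) →
  Unique xs × Unique ys × (∀ {x y} → x ∈ xs → y ∈ ys → x ≢ y)
Unique-++⁻ [] u = [] , u , λ ()
Unique-++⁻ (x ∷ xs) (x∉ ∷ u) with Unique-++⁻ xs u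
... | uxs , uys , disjoint =
  (All.++⁻ˡ xs x∉ ∷ uxs) , uys ,
  λ { (here refl) y∈ → All.lookup (All.++⁻ʳ xs x∉) y∈ ; (there x∈) y∈ → disjoint x∈ y∈ }

row-injective : ∀ row {c c′} → Unique row → c < length row → c′ < length row →
  rowEntry row c ≡ rowEntry row c′ → c ≡ c′
row-injective (x ∷ row) {zero} {zero} _ _ _ _ = refl
row-injective (x ∷ row) {zero} {suc c′} (x∉ ∷ _) _ (s≤s c′<) e =
  ⊥-elim (All.lookup x∉ (rowEntry-∈ row c′ c′<) e)
row-injective (x ∷ row) {suc c} {zero} (x∉ ∷ _) (s≤s c<) _ e =
  ⊥-elim (All.lookup x∉ (rowEntry-∈ row c c<) (sym e))
row-injective (x ∷ row) {suc c} {suc c′} (_ ∷ u) (s≤s c<) (s≤s c′<) e =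
  cong suc (row-injective row u c< c′< e)

ent-injective : ∀ U {r c r′ c′} → Unique (concat U) →
  InShape (map length U) r c → InShape (map length U) r′ c′ →
  ent U r c ≡ ent U r′ c′ → (r , c) ≡ (r′ , c′)
ent-injective (row ∷ U) {zero} {c} {zero} {c′} u s s′ e
  with urow , _ , _ ← Unique-++⁻ row {concat U} u =
  cong (0 ,_) (row-injective row urow s s′ e)
ent-injective (row ∷ U) {zero} {c} {suc r′} {c′} u s s′ e
  with _ , _ , disjoint ← Unique-++⁻ row {concat U} u =
  ⊥-elim (disjoint (rowEntry-∈ row c s) (ent-∈-concat U r′ c′ s′) e)
ent-injective (row ∷ U) {suc r} {c} {zero} {c′} u s s′ e
  with _ , _ , disjoint ← Unique-++⁻ row {concat U} u =
  ⊥-elim (disjoint (rowEntry-∈ row c′ s′) (ent-∈-concat U r c s) (sym e))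
ent-injective (row ∷ U) {suc r} {c} {suc r′} {c′} u s s′ e
  with _ , uU , _ ← Unique-++⁻ row {concat U} u =
  cong (λ x → suc (proj₁ x) , proj₂ x) (ent-injective U uU s s′ e)

findInRow-sound : ∀ row {k c} → findInRow row k ≡ just c → c < length row × rowEntry row c ≡ k
findInRow-sound (x ∷ row) {k} e with x ≡ᵇ k | proof (x ≟ k) | findInRow row k in eq
findInRow-sound (x ∷ row) refl | true | ofʸ x≡k | _ = s≤s z≤n , x≡k
findInRow-sound (x ∷ row) refl | false | ofⁿ _ | just c with c< , e ← findInRow-sound row eq = s≤s c< , e

findPos-sound : ∀ U {k r c} → findPos U k ≡ just (r , c) →
  InShape (map length U) r c × ent U r c ≡ k
findPos-sound (row ∷ U) {k} e with findInRow row k in eq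
findPos-sound (row ∷ U) refl | just c = findInRow-sound row eq
... | nothing with findPos U k in eq′
findPos-sound (row ∷ U) refl | nothing | just (r , c) = findPos-sound U eq′

findInRow-complete : ∀ row {k} → k ∈ row → ∃ λ c → findInRow row k ≡ just c
findInRow-complete (x ∷ row) {k} k∈ with x ≡ᵇ k | proof (x ≟ k) | k∈
... | true | _ | _ = 0 , refl
... | false | ofⁿ x≢k | here k≡x = ⊥-elim (x≢k (sym k≡x))
... | false | _ | there k∈row with c , e ← findInRow-complete row k∈row rewrite e = suc c , refl

findPos-complete : ∀ U {k} → k ∈ concat U → ∃ λ x → findPos U k ≡ just x
findPos-complete (row ∷ U) {k} k∈ with findInRow row k in eq | ∈-++⁻ row k∈
... | just c | _ = (0 , c) , refl
... | nothing | inj₁ k∈row with () ← trans (sym eq) (proj₂ (findInRow-complete row k∈row))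
... | nothing | inj₂ k∈U with (r , c) , e ← findPos-complete U k∈U rewrite e = (suc r , c) , refl

findPos≡pos : ∀ U {k} → k ∈ concat U → findPos U k ≡ just (pos U k)
findPos≡pos U k∈ with findPos-complete U k∈
... | x , e rewrite e = refl

findInRow-map : ∀ f row {k k′} → (∀ x → f x ≡ k ⇔ x ≡ k′) →
  findInRow (map f row) k ≡ findInRow row k′
findInRow-map f [] _ = refl
findInRow-map f (x ∷ row) {k} {k′} f≡k⇔ rewrite does-⇔ (f≡k⇔ x) (f x ≟ k) (x ≟ k′)
  | findInRow-map f row f≡k⇔ = refl

findPos-map : ∀ f U {k k′} → (∀ x → f x ≡ k ⇔ x ≡ k′) →
  findPos (map (map f) U) k ≡ findPos U k′
findPos-map f [] _ = refl
findPos-map f (row ∷ U) {k} {k′} f≡k⇔ rewrite findInRow-map f row f≡k⇔ with findInRow row k′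
... | just c = refl
... | nothing = cong (Maybe.map (λ x → suc (proj₁ x) , proj₂ x)) (findPos-map f U f≡k⇔)

swapEntry-left : ∀ a → swapEntry a a ≡ suc a
swapEntry-left a rewrite dec-true (a ≟ a) refl = refl

swapEntry-right : ∀ a → swapEntry a (suc a) ≡ a
swapEntry-right a rewrite dec-false (suc a ≟ a) (1+n≢n) | dec-true (suc a ≟ suc a) refl = refl

swapEntry-fixes : ∀ a {x} → x ≢ a → x ≢ suc a → swapEntry a x ≡ x
swapEntry-fixes a {x} x≢a x≢1+a rewrite dec-false (x ≟ a) x≢a | dec-false (x ≟ suc a) x≢1+a = refl

swapEntry-involutive : ∀ a x → swapEntry a (swapEntry a x) ≡ x
swapEntry-involutive a x with x ≟ a | x ≟ suc a
... | yes refl | _ = trans (cong (swapEntry x) (swapEntry-left x)) (swapEntry-right x)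
... | no _ | yes refl = trans (cong (swapEntry a) (swapEntry-right a)) (swapEntry-left a)
... | no x≢a | no x≢1+a =
  trans (cong (swapEntry a) (swapEntry-fixes a x≢a x≢1+a)) (swapEntry-fixes a x≢a x≢1+a)

rowAt-map : ∀ (f : ℕ → ℕ) U r → rowAt (map (map f) U) r ≡ map f (rowAt U r)
rowAt-map f U r rewrite nth-map (map f) U r with nth U r
... | just _ = refl
... | nothing = refl

rowEntry-map : ∀ f → f 0 ≡ 0 → ∀ row c → rowEntry (map f row) c ≡ f (rowEntry row c)
rowEntry-map f f0≡0 row c rewrite nth-map f row c with nth row c
... | just _ = refl
... | nothing = sym f0≡0

-- ent pads with 0 outside the diagram, so only relabellings fixing 0 commute with it.
ent-map : ∀ f → f 0 ≡ 0 → ∀ U r c → ent (map (map f) U) r c ≡ f (ent U r c)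
ent-map f f0≡0 U r c = begin
  ent (map (map f) U) r c               ≡⟨ ent-rowAt (map (map f) U) r c ⟩
  rowEntry (rowAt (map (map f) U) r) c  ≡⟨ cong (λ row → rowEntry row c) (rowAt-map f U r) ⟩
  rowEntry (map f (rowAt U r)) c        ≡⟨ rowEntry-map f f0≡0 (rowAt U r) c ⟩
  f (rowEntry (rowAt U r) c)            ≡⟨ cong f (ent-rowAt U r c) ⟨
  f (ent U r c)                         ∎
  where open ≡-Reasoning

shape-map : ∀ (f : ℕ → ℕ) U → map length (map (map f) U) ≡ map length U
shape-map f U = trans (sym (map-∘ U)) (map-cong (length-map f) U)

column-map : ∀ (f : ℕ → ℕ) U c → column (map (map f) U) c ≡ map f (column U c)
column-map f [] c = refl
column-map f (row ∷ U) c rewrite nth-map f row c with nth row c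
... | just x = cong (f x ∷_) (column-map f U c)
... | nothing = column-map f U c

colWord-map : ∀ (f : ℕ → ℕ) U → colWord (map (map f) U) ≡ map f (colWord U)
colWord-map f U rewrite shape-map f U = begin
  concat (map (column (map (map f) U)) cs) ≡⟨ cong concat (map-cong (column-map f U) cs) ⟩
  concat (map (map f ∘ column U) cs)       ≡⟨ cong concat (map-∘ cs) ⟩
  concat (map (map f) (map (column U) cs)) ≡⟨ concat-map (map (column U) cs) ⟩
  map f (colWord U)                        ∎
  where
  open ≡-Reasoning
  cs = upTo (foldr _⊔_ 0 (map length U))

pos-swapT : ∀ a U k → pos (swapT a U) k ≡ pos U (swapEntry a k)
pos-swapT a U k = cong (maybe′ id (0 , 0)) (findPos-map (swapEntry a) U λ x →
  mk⇔ (λ e → trans (sym (swapEntry-involutive a x)) (cong (swapEntry a) e))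
      (λ e → trans (cong (swapEntry a) e) (swapEntry-involutive a k)))

pos-swapT-moved : ∀ a U → pos (swapT a U) (suc a) ≡ pos U a
pos-swapT-moved a U = trans (pos-swapT a U (suc a)) (cong (pos U) (swapEntry-right a))

pos-swapT-fixed : ∀ a U {m} → suc a < m → pos (swapT a U) m ≡ pos U m
pos-swapT-fixed a U 1+a<m =
  trans (pos-swapT a U _) (cong (pos U) (swapEntry-fixes a (>⇒≢ (<-trans (n<1+n a) 1+a<m)) (>⇒≢ 1+a<m)))

-- The cycle s_{j-1} ⋯ s_{i+1} s_i

ascending : ℕ → ℕ → List ℕ
ascending a zero = []
ascending a (suc d) = a ∷ ascending (suc a) d

applyUpTo-ascending : ∀ f a d → (∀ x → f x ≡ a + x) → applyUpTo f d ≡ ascending a d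
applyUpTo-ascending f a zero f≗a+ = refl
applyUpTo-ascending f a (suc d) f≗a+ =
  cong₂ _∷_ (trans (f≗a+ 0) (+-identityʳ a))
    (applyUpTo-ascending (f ∘ suc) (suc a) d (λ x → trans (f≗a+ (suc x)) (+-suc a x)))

cycWord-+≡ascending : ∀ i d → cycWord i (i + d) ≡ ascending i d
cycWord-+≡ascending i d rewrite m+n∸m≡n i d =
  trans (map-upTo (i +_) d) (applyUpTo-ascending (i +_) i d (λ _ → refl))

applyWord-ascending-below : ∀ a d {x} → x < a → applyWord (ascending a d) x ≡ x
applyWord-ascending-below a zero x<a = refl
applyWord-ascending-below a (suc d) {x} x<a
  rewrite swapEntry-fixes a (<⇒≢ x<a) (<⇒≢ (m<n⇒m<1+n x<a)) =
  applyWord-ascending-below (suc a) d (m<n⇒m<1+n x<a)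

applyWord-ascending-above : ∀ a d {x} → a + d < x → applyWord (ascending a d) x ≡ x
applyWord-ascending-above a zero x> = refl
applyWord-ascending-above a (suc d) {x} x> =
  trans (cong (applyWord (ascending (suc a) d)) (swapEntry-fixes a (>⇒≢ (<-trans (n<1+n a) 1+a<x)) (>⇒≢ 1+a<x)))
    (applyWord-ascending-above (suc a) d (subst (_< x) (+-suc a d) x>))
  where
  1+a<x : suc a < x
  1+a<x = ≤-<-trans (subst (suc a ≤_) (sym (+-suc a d)) (s≤s (m≤m+n a d))) x>

applyWord-ascending-start : ∀ a d → applyWord (ascending a d) a ≡ a + d
applyWord-ascending-start a zero = sym (+-identityʳ a)
applyWord-ascending-start a (suc d) rewrite swapEntry-left a =
  trans (applyWord-ascending-start (suc a) d) (sym (+-suc a d))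

applyWord-ascending-shift : ∀ a d {y} → a ≤ y → y < a + d → applyWord (ascending a d) (suc y) ≡ y
applyWord-ascending-shift a zero a≤y y< = ⊥-elim (<⇒≱ y< (subst (_≤ _) (sym (+-identityʳ a)) a≤y))
applyWord-ascending-shift a (suc d) {y} a≤y y< with a ≟ y
... | yes refl rewrite swapEntry-right a = applyWord-ascending-below (suc a) d (n<1+n a)
... | no a≢y rewrite swapEntry-fixes a {suc y} (>⇒≢ (s≤s a≤y)) (a≢y ∘ sym ∘ suc-injective) =
   applyWord-ascending-shift (suc a) d (≤∧≢⇒< a≤y a≢y) (subst (y <_) (+-suc a d) y<)

All-ascending : ∀ {P : ℕ → Set} a d → (∀ k → a ≤ k → k < a + d → P k) → All P (ascending a d)
All-ascending a zero _ = []
All-ascending a (suc d) P-in-range =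
  P-in-range a ≤-refl (subst (a <_) (sym (+-suc a d)) (s≤s (m≤m+n a d))) ∷
  All-ascending (suc a) d (λ k a<k k< → P-in-range k (<⇒≤ a<k) (subst (k <_) (sym (+-suc a d)) k<))

module Cycle {i j : ℕ} (i<j : i < j) where

  σ : ℕ → ℕ
  σ = applyWord (cycWord i j)

  private
    d : ℕ
    d = j ∸ i

    i+d≡j : i + d ≡ j
    i+d≡j = m+[n∸m]≡n (<⇒≤ i<j)

  cycWord≡ascending : cycWord i j ≡ ascending i (j ∸ i)
  cycWord≡ascending = subst (λ t → cycWord i t ≡ ascending i d) i+d≡j (cycWord-+≡ascending i d)

  private
    σ≗ : ∀ x → σ x ≡ applyWord (ascending i d) x
    σ≗ x = cong (λ w → applyWord w x) cycWord≡ascending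

  σ-below : ∀ {x} → x < i → σ x ≡ x
  σ-below x<i = trans (σ≗ _) (applyWord-ascending-below i d x<i)

  σ-above : ∀ {x} → j < x → σ x ≡ x
  σ-above j<x = trans (σ≗ _) (applyWord-ascending-above i d (subst (_< _) (sym i+d≡j) j<x))

  σ-start : σ i ≡ j
  σ-start = trans (σ≗ i) (trans (applyWord-ascending-start i d) i+d≡j)

  σ-shift : ∀ {y} → i ≤ y → y < j → σ (suc y) ≡ y
  σ-shift i≤y y<j = trans (σ≗ _) (applyWord-ascending-shift i d i≤y (subst (_ <_) (sym i+d≡j) y<j))

  Flip : ℕ → ℕ → Set
  Flip a b = a ≡ i × i < b × b ≤ j

  data Region (x : ℕ) : Set where
    below   : x < i → Region x
    start   : x ≡ i → Region x
    shifted : ∀ y → x ≡ suc y → i ≤ y → y < j → Region x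
    above   : j < x → Region x

  region : ∀ x → Region x
  region x with <-cmp x i
  ... | tri< x<i _ _ = below x<i
  ... | tri≈ _ x≡i _ = start x≡i
  ... | tri> _ _ i<x with x ≤? j
  ...   | no x≰j = above (≰⇒> x≰j)
  region (suc y) | tri> _ _ (s≤s i≤y) | yes y<j = shifted y refl i≤y y<j

  σ-strictMono : ∀ {a b} → a < b → ¬ Flip a b → σ a < σ b
  σ-strictMono {a} {b} a<b no-flip with region a | region b
  ... | below a<i | below b<i rewrite σ-below a<i | σ-below b<i = a<b
  ... | below a<i | start refl rewrite σ-below a<i | σ-start = <-trans a<i i<j
  ... | below a<i | shifted y refl i≤y y<j rewrite σ-below a<i | σ-shift i≤y y<j = <-≤-trans a<i i≤y
  ... | below a<i | above j<b rewrite σ-below a<i | σ-above j<b = a<b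
  ... | start refl | below b<i = ⊥-elim (<-asym a<b b<i)
  ... | start refl | start refl = ⊥-elim (<-irrefl refl a<b)
  ... | start refl | shifted y refl i≤y y<j = ⊥-elim (no-flip (refl , a<b , y<j))
  ... | start refl | above j<b rewrite σ-start | σ-above j<b = j<b
  ... | shifted y refl i≤y _ | below b<i = ⊥-elim (<-asym (<-≤-trans b<i i≤y) (<-trans (n<1+n y) a<b))
  ... | shifted y refl i≤y _ | start refl = ⊥-elim (<-asym a<b (s≤s i≤y))
  ... | shifted y refl i≤y y<j | shifted y′ refl i≤y′ y′<j
    rewrite σ-shift i≤y y<j | σ-shift i≤y′ y′<j = ≤-pred a<b
  ... | shifted y refl i≤y y<j | above j<b rewrite σ-shift i≤y y<j | σ-above j<b = <-trans y<j j<b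
  ... | above j<a | below b<i = ⊥-elim (<-asym a<b (<-trans b<i (<-trans i<j j<a)))
  ... | above j<a | start refl = ⊥-elim (<-asym a<b (<-trans i<j j<a))
  ... | above j<a | shifted y refl _ y<j = ⊥-elim (<-asym a<b (<-≤-trans (s≤s y<j) j<a))
  ... | above j<a | above j<b rewrite σ-above j<a | σ-above j<b = a<b

  σ-<-⇔ : ∀ {a b} → ¬ Flip a b → ¬ Flip b a → a < b ⇔ σ a < σ b
  σ-<-⇔ {a} {b} ¬ab ¬ba = mk⇔ (λ a<b → σ-strictMono a<b ¬ab) reflect
    where
    reflect : σ a < σ b → a < b
    reflect σa<σb with <-cmp a b
    ... | tri< a<b _ _ = a<b
    ... | tri≈ _ refl _ = ⊥-elim (<-irrefl refl σa<σb)
    ... | tri> _ _ b<a = ⊥-elim (<-asym σa<σb (σ-strictMono b<a ¬ba))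

∈-range⁺ : ∀ {n x} → 1 ≤ x → x ≤ n → x ∈ map suc (upTo n)
∈-range⁺ {x = suc x} _ x<n = ∈-map⁺ suc (∈-upTo⁺ x<n)

∈-range⁻ : ∀ {n x} → x ∈ map suc (upTo n) → 1 ≤ x × x ≤ n
∈-range⁻ x∈ with _ , y∈ , refl ← ∈-map⁻ suc x∈ = s≤s z≤n , ∈-upTo⁻ y∈

Unique-range : ∀ n → Unique (map suc (upTo n))
Unique-range n = Unique.map⁺ suc-injective (Unique.upTo⁺ n)

swapEntry-∈-range : ∀ {n a x} → 1 ≤ a → suc a ≤ n →
  x ∈ map suc (upTo n) → swapEntry a x ∈ map suc (upTo n)
swapEntry-∈-range {n} {a} {x} 1≤a a<n x∈ with x ≟ a | x ≟ suc a
... | yes refl | _ rewrite swapEntry-left x = ∈-range⁺ (s≤s z≤n) a<n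
... | no _ | yes refl rewrite swapEntry-right a = ∈-range⁺ 1≤a (<⇒≤ a<n)
... | no x≢a | no x≢1+a rewrite swapEntry-fixes a x≢a x≢1+a = x∈

map-swapEntry-↭ : ∀ a {xs} → Unique xs → (∀ {x} → x ∈ xs → swapEntry a x ∈ xs) →
  map (swapEntry a) xs ↭ xs
map-swapEntry-↭ a {xs} u closed =
  ∼bag⇒↭ (unique∧set⇒bag (Unique.map⁺ swap-injective u) u (mk⇔ image⊆ ⊆image))
  where
  swap-injective : ∀ {x y} → swapEntry a x ≡ swapEntry a y → x ≡ y
  swap-injective {x} {y} e =
    trans (sym (swapEntry-involutive a x)) (trans (cong (swapEntry a) e) (swapEntry-involutive a y))
  image⊆ : ∀ {x} → x ∈ map (swapEntry a) xs → x ∈ xs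
  image⊆ x∈ with _ , y∈ , refl ← ∈-map⁻ (swapEntry a) x∈ = closed y∈
  ⊆image : ∀ {x} → x ∈ xs → x ∈ map (swapEntry a) xs
  ⊆image {x} x∈ = subst (_∈ _) (swapEntry-involutive a x) (∈-map⁺ (swapEntry a) (closed x∈))

map-applyWord-↭ : ∀ w {xs} → Unique xs → All (λ a → ∀ {x} → x ∈ xs → swapEntry a x ∈ xs) w →
  map (applyWord w) xs ↭ xs
map-applyWord-↭ [] {xs} _ _ = ↭-reflexive (map-id xs)
map-applyWord-↭ (a ∷ w) {xs} u (closed ∷ closedw) = begin
  map (applyWord w ∘ swapEntry a) xs       ≡⟨ map-∘ xs ⟩
  map (applyWord w) (map (swapEntry a) xs) ↭⟨ ↭.map⁺ (applyWord w) (map-swapEntry-↭ a u closed) ⟩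
  map (applyWord w) xs                     ↭⟨ map-applyWord-↭ w u closedw ⟩
  xs                                       ∎
  where open PermutationReasoning

-- The 0-Hecke action along an ascending word

piAct-swaps : ∀ a U → InD U a → ¬ AttacksIn U a (suc a) → piAct a U ≡ just (swapT a U)
piAct-swaps a U a∈D ¬att
  rewrite dec-true (col U a ≤? col U (suc a)) a∈D | dec-false (attacks? (pos U a) (pos U (suc a))) ¬att = refl

piAct-vanishes : ∀ a U → InD U a → AttacksIn U a (suc a) → piAct a U ≡ nothing
piAct-vanishes a U a∈D att
  rewrite dec-true (col U a ≤? col U (suc a)) a∈D | dec-true (attacks? (pos U a) (pos U (suc a))) att = refl

MovesFreely : Tableau → ℕ → ℕ → Set
MovesFreely U a d = ∀ m → a < m → m ≤ a + d → col U a ≤ col U m × ¬ AttacksIn U a m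

movesFreely-swapT : ∀ U a d → MovesFreely U a (suc d) → MovesFreely (swapT a U) (suc a) d
movesFreely-swapT U a d free m 1+a<m m≤ =
  subst₂ (λ x y → proj₂ x ≤ proj₂ y × ¬ Attacks x y) (sym (pos-swapT-moved a U)) (sym (pos-swapT-fixed a U 1+a<m))
    (free m (<-trans (n<1+n a) 1+a<m) (subst (m ≤_) (sym (+-suc a d)) m≤))

piWord-ascending-moves : ∀ U a d → MovesFreely U a d →
  piWord (ascending a d) (just U) ≡ just (map (map (applyWord (ascending a d))) U)
piWord-ascending-moves U a zero _ = cong just (sym (trans (map-cong map-id U) (map-id U)))
piWord-ascending-moves U a (suc d) free = begin
  piWord (ascending (suc a) d) (piAct a U)
    ≡⟨ cong (piWord (ascending (suc a) d)) (piAct-swaps a U a∈D ¬att) ⟩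
  piWord (ascending (suc a) d) (just (swapT a U))
    ≡⟨ piWord-ascending-moves (swapT a U) (suc a) d (movesFreely-swapT U a d free) ⟩
  just (map (map w) (map (map (swapEntry a)) U))
    ≡⟨ cong just (trans (sym (map-∘ U)) (map-cong (λ row → sym (map-∘ row)) U)) ⟩
  just (map (map (w ∘ swapEntry a)) U)
    ∎
  where
  open ≡-Reasoning
  w = applyWord (ascending (suc a) d)
  a∈D = proj₁ (free (suc a) (n<1+n a) (m<m+n a (s≤s z≤n)))
  ¬att = proj₂ (free (suc a) (n<1+n a) (m<m+n a (s≤s z≤n)))

piWord-ascending-vanishes : ∀ U a d → MovesFreely U a d →
  col U a ≤ col U (suc (a + d)) → AttacksIn U a (suc (a + d)) →
  piWord (ascending a (suc d)) (just U) ≡ nothing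
piWord-ascending-vanishes U a zero _ a∈D att
  rewrite +-identityʳ a | piAct-vanishes a U a∈D att = refl
piWord-ascending-vanishes U a (suc d) free a≤last att = begin
  piWord (ascending (suc a) (suc d)) (piAct a U)
    ≡⟨ cong (piWord (ascending (suc a) (suc d))) (piAct-swaps a U a∈D ¬att) ⟩
  piWord (ascending (suc a) (suc d)) (just (swapT a U))
    ≡⟨ piWord-ascending-vanishes (swapT a U) (suc a) d (movesFreely-swapT U a d free)
         (subst₂ (λ x y → proj₂ x ≤ proj₂ y) moved fixed a≤last) (subst₂ Attacks moved fixed att) ⟩
  nothing
    ∎
  where
  open ≡-Reasoning
  a∈D = proj₁ (free (suc a) (n<1+n a) (m<m+n a (s≤s z≤n)))
  ¬att = proj₂ (free (suc a) (n<1+n a) (m<m+n a (s≤s z≤n)))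
  moved : pos U a ≡ pos (swapT a U) (suc a)
  moved = sym (pos-swapT-moved a U)
  fixed : pos U (suc (a + suc d)) ≡ pos (swapT a U) (suc (suc a + d))
  fixed = trans (cong (pos U ∘ suc) (+-suc a d)) (sym (pos-swapT-fixed a U (s≤s (s≤s (m≤m+n a d)))))

-- Standard composition tableaux

Cell : Set
Cell = ℕ × ℕ

rowOf colOf : Cell → ℕ
rowOf = proj₁
colOf = proj₂

entry : Tableau → Cell → ℕ
entry U x = ent U (proj₁ x) (proj₂ x)

InDiagram : List ℕ → Cell → Set
InDiagram α x = InShape α (proj₁ x) (proj₂ x)

InShape-first : ∀ {α} r → All (0 <_) α → r < length α → InShape α r 0
InShape-first zero (0<a ∷ _) _ = 0<a
InShape-first (suc r) (_ ∷ 0<α) (s≤s r<) = InShape-first r 0<α r<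

Attacks⇒col≤ : ∀ {x y} → Attacks x y → colOf x ≤ colOf y
Attacks⇒col≤ (inj₁ (col≡ , _)) = ≤-reflexive col≡
Attacks⇒col≤ (inj₂ (1+col≡ , _)) = subst (_ ≤_) 1+col≡ (n≤1+n _)

Attacks-sameColumn⇒row≢ : ∀ {x y} → Attacks x y → colOf x ≡ colOf y → rowOf x ≢ rowOf y
Attacks-sameColumn⇒row≢ (inj₁ (_ , row≢)) _ = row≢
Attacks-sameColumn⇒row≢ (inj₂ (1+col≡ , _)) col≡ = ⊥-elim (1+n≢n (trans 1+col≡ (sym col≡)))

module SCT {n α U} (S : IsSCT n α U) where
  open IsSCT S

  private
    toFilling : ∀ {x} → InDiagram α x → InDiagram (map length U) x
    toFilling {r , _} = subst (λ β → InShape β r _) (sym shape)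

    fromFilling : ∀ {x} → InDiagram (map length U) x → InDiagram α x
    fromFilling {r , _} = subst (λ β → InShape β r _) shape

  entries-unique : Unique (concat U)
  entries-unique = Unique-resp-↭ (↭⇒↭ₛ (↭-sym bij)) (Unique-range n)

  entry-range : ∀ {x} → InDiagram α x → 1 ≤ entry U x × entry U x ≤ n
  entry-range {r , c} s = ∈-range⁻ (↭.∈-resp-↭ bij (ent-∈-concat U r c (toFilling s)))

  entry-injective : ∀ {x y} → InDiagram α x → InDiagram α y → entry U x ≡ entry U y → x ≡ y
  entry-injective sx sy = ent-injective U entries-unique (toFilling sx) (toFilling sy)

  findPos-entry : ∀ {k} → 1 ≤ k → k ≤ n → findPos U k ≡ just (pos U k)
  findPos-entry 1≤k k≤n = findPos≡pos U (↭.∈-resp-↭ (↭-sym bij) (∈-range⁺ 1≤k k≤n))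

  pos-sound : ∀ {k} → 1 ≤ k → k ≤ n → InDiagram α (pos U k) × entry U (pos U k) ≡ k
  pos-sound 1≤k k≤n with s , e ← findPos-sound U (findPos-entry 1≤k k≤n) = fromFilling s , e

  pos-entry : ∀ {x} → InDiagram α x → pos U (entry U x) ≡ x
  pos-entry s with 1≤e , e≤n ← entry-range s with s′ , e ← pos-sound 1≤e e≤n =
    entry-injective s′ s e

  row-decreasing : ∀ r {c c′} → InShape α r c′ → c < c′ → ent U r c′ < ent U r c
  row-decreasing r {c} {suc c′} s (s≤s c≤c′) with m≤n⇒m<n∨m≡n c≤c′
  ... | inj₂ refl = rowDec r c s
  ... | inj₁ c<c′ = <-trans (rowDec r c′ s) (row-decreasing r (≤-<-trans (n≤1+n c′) s) c<c′)

source-column-bound : ∀ {n U} → IsSource n U → ∀ c lo hi → 1 ≤ lo → hi ≤ suc n →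
  c ≤ col U lo →
  (∀ k → lo ≤ k → suc k < hi → ¬ InD U k → col U k ≢ c) →
  ∀ k → lo ≤ k → k < hi → c ≤ col U k
source-column-bound {n} {U} source c lo hi 1≤lo hi≤ c≤lo leaves-c = go
  where
  go : ∀ k → lo ≤ k → k < hi → c ≤ col U k
  go k lo≤k k<hi with m≤n⇒m<n∨m≡n lo≤k
  ... | inj₂ refl = c≤lo
  go zero _ _ | inj₁ ()
  go (suc k) _ k<hi | inj₁ (s≤s lo≤k) with col U k ≤? col U (suc k)
  ... | yes k∈D = ≤-trans (go k lo≤k (<-trans (n<1+n k) k<hi)) k∈D
  ... | no k∉D = ≤-pred (subst (c <_) (sym left-adjacent) c<col)
    where
    left-adjacent = proj₂ (source k (≤-trans 1≤lo lo≤k) (≤-pred (<-≤-trans k<hi hi≤)) k∉D)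
    c<col = ≤∧≢⇒< (go k lo≤k (<-trans (n<1+n k) k<hi)) (λ e → leaves-c k lo≤k k<hi k∉D (sym e))

module Lemma49
  {n : ℕ} {α : List ℕ} {T₀ T : Tableau}
  (S₀ : IsSCT n α T₀) (source : IsSource n T₀) (S : IsSCT n α T) (equiv : Equiv α T T₀)
  (descents⊆ : ∀ k → 1 ≤ k → k < n → InD T k → InD T₀ k)
  {i : ℕ} (1≤i : 1 ≤ i) (i≤n : i ≤ n) (i-moved : findPos T i ≢ findPos T₀ i)
  (above-i-fixed : ∀ k → i < k → k ≤ n → findPos T k ≡ findPos T₀ k)
  {j : ℕ} (i<j : i < j) (j≤n : j ≤ n) (i-attacks-j : AttacksIn T₀ i j)
  (j-first : ∀ k → i < k → k < j → ¬ AttacksIn T₀ i k)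
  where

  module SCT₀ = SCT S₀
  module SCTₜ = SCT S

  P : ℕ → Cell
  P = pos T₀

  p q : Cell
  p = P i
  q = pos T i

  pos-fixed : ∀ {k} → i < k → k ≤ n → pos T k ≡ P k
  pos-fixed i<k k≤n = cong (maybe′ id (0 , 0)) (above-i-fixed _ i<k k≤n)

  P-sound : ∀ {k} → 1 ≤ k → k ≤ n → InDiagram α (P k) × entry T₀ (P k) ≡ k
  P-sound = SCT₀.pos-sound

  p-sound : InDiagram α p × entry T₀ p ≡ i
  p-sound = P-sound 1≤i i≤n

  q-sound : InDiagram α q × entry T q ≡ i
  q-sound = SCTₜ.pos-sound 1≤i i≤n

  cell≡q : ∀ {x} → InDiagram α x → entry T x ≡ i → x ≡ q
  cell≡q s x↦i = SCTₜ.entry-injective s (proj₁ q-sound) (trans x↦i (sym (proj₂ q-sound)))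

  cell≡p : ∀ {x} → InDiagram α x → entry T₀ x ≡ i → x ≡ p
  cell≡p s x↦i = SCT₀.entry-injective s (proj₁ p-sound) (trans x↦i (sym (proj₂ p-sound)))

  q≢p : q ≢ p
  q≢p q≡p = i-moved (begin
    findPos T i   ≡⟨ SCTₜ.findPos-entry 1≤i i≤n ⟩
    just q        ≡⟨ cong just q≡p ⟩
    just p        ≡⟨ SCT₀.findPos-entry 1≤i i≤n ⟨
    findPos T₀ i  ∎)
    where open ≡-Reasoning

  P-entry-T : ∀ {x} → InDiagram α x → i < entry T x → P (entry T x) ≡ x
  P-entry-T s i< = trans (sym (pos-fixed i< (proj₂ (SCTₜ.entry-range s)))) (SCTₜ.pos-entry s)

  entry-T₀≡T : ∀ {x} → InDiagram α x → i < entry T x → entry T₀ x ≡ entry T x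
  entry-T₀≡T s i< with 1≤e , e≤n ← SCTₜ.entry-range s =
    trans (cong (entry T₀) (sym (P-entry-T s i<))) (proj₂ (P-sound 1≤e e≤n))

  entry-T≡T₀ : ∀ {x} → InDiagram α x → i < entry T₀ x → entry T x ≡ entry T₀ x
  entry-T≡T₀ s i< with 1≤e , e≤n ← SCT₀.entry-range s =
    trans (cong (entry T) (sym (trans (pos-fixed i< e≤n) (SCT₀.pos-entry s)))) (proj₂ (SCTₜ.pos-sound 1≤e e≤n))

  small-T⇒T₀ : ∀ {x} → InDiagram α x → entry T x ≤ i → entry T₀ x ≤ i
  small-T⇒T₀ s e≤i = ≮⇒≥ λ i< → <⇒≱ (subst (i <_) (sym (entry-T≡T₀ s i<)) i<) e≤i

  small-T₀⇒T : ∀ {x} → InDiagram α x → entry T₀ x ≤ i → entry T x ≤ i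
  small-T₀⇒T s e₀≤i = ≮⇒≥ λ i< → <⇒≱ (subst (i <_) (sym (entry-T₀≡T s i<)) i<) e₀≤i

  column-order : ∀ {x y} → InDiagram α x → InDiagram α y → colOf x ≡ colOf y →
    entry T x < entry T y ⇔ entry T₀ x < entry T₀ y
  column-order {r , c} {r′ , .c} sx sy refl = equiv r r′ c sx sy

  v : ℕ
  v = entry T₀ q

  v<i : v < i
  v<i = ≤∧≢⇒< (small-T⇒T₀ (proj₁ q-sound) (≤-reflexive (proj₂ q-sound)))
    (q≢p ∘ cell≡p (proj₁ q-sound))

  Tp<i : entry T p < i
  Tp<i = ≤∧≢⇒< (small-T₀⇒T (proj₁ p-sound) (≤-reflexive (proj₂ p-sound)))
    (q≢p ∘ sym ∘ cell≡q (proj₁ p-sound))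

  below-q-in-T₀ : ∀ {y} → InDiagram α y → colOf y ≡ colOf q → y ≢ q → entry T y ≤ i → entry T₀ y < v
  below-q-in-T₀ s col≡ y≢q e≤i = to (column-order s (proj₁ q-sound) col≡)
    (subst (_ <_) (sym (proj₂ q-sound))
      (≤∧≢⇒< e≤i (y≢q ∘ cell≡q s)))

  below-p-in-T : ∀ {y} → InDiagram α y → colOf y ≡ colOf p → y ≢ p → entry T₀ y ≤ i → entry T y < entry T p
  below-p-in-T s col≡ y≢p e≤i = from (column-order s (proj₁ p-sound) col≡)
    (subst (_ <_) (sym (proj₂ p-sound))
      (≤∧≢⇒< e≤i (y≢p ∘ cell≡p s)))

  left-of-q-in-row : ∀ {z} → rowOf z ≡ rowOf q → colOf z < colOf q → i < entry T z
  left-of-q-in-row {_ , c} refl c< =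
    subst (_< ent T (rowOf q) c) (proj₂ q-sound) (SCTₜ.row-decreasing (rowOf q) (proj₁ q-sound) c<)

  right-of-q-in-row : ∀ {z} → InDiagram α z → rowOf z ≡ rowOf q → colOf q < colOf z → entry T z < i
  right-of-q-in-row {_ , c} s refl q< =
    subst (ent T (rowOf q) c <_) (proj₂ q-sound) (SCTₜ.row-decreasing (rowOf q) s q<)

  col-q≢col-p : colOf q ≢ colOf p
  col-q≢col-p col≡ = <-asym v<i (subst (_< v) (proj₂ p-sound)
    (below-q-in-T₀ (proj₁ p-sound) (sym col≡) (q≢p ∘ sym) (<⇒≤ Tp<i)))

  1≤v : 1 ≤ v
  1≤v = proj₁ (SCT₀.entry-range (proj₁ q-sound))

  -- Along v, …, i a non-descent k puts k+1 just left of k in its row, so k is never in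
  -- column col q: at q, T would have an entry above i left of i; elsewhere in that
  -- column, the column order of T forces k < v.
  col-q<col-p : colOf q < colOf p
  col-q<col-p = ≤∧≢⇒< (source-column-bound {U = T₀} source (colOf q) v (suc i) 1≤v (s≤s i≤n)
      (≤-reflexive (cong colOf (sym (SCT₀.pos-entry (proj₁ q-sound))))) leaves-col-q i (<⇒≤ v<i) (n<1+n i))
    col-q≢col-p
    where
    leaves-col-q : ∀ k → v ≤ k → suc k < suc i → ¬ InD T₀ k → colOf (P k) ≢ colOf q
    leaves-col-q k v≤k (s≤s k<i) k∉D col≡ with ≡-dec _≟_ _≟_ (P k) q
    ... | no Pk≢q = <⇒≱ (subst (_< v) (proj₂ Pk-sound)
        (below-q-in-T₀ (proj₁ Pk-sound) col≡ Pk≢q (small-T₀⇒T (proj₁ Pk-sound) Pk≤i))) v≤k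
      where
      Pk-sound = P-sound (≤-trans 1≤v v≤k) (≤-trans (<⇒≤ k<i) i≤n)
      Pk≤i = subst (_≤ i) (sym (proj₂ Pk-sound)) (<⇒≤ k<i)
    ... | yes Pk≡q = <⇒≱ i<Tz (subst (_≤ i) (sym Tz≡1+k) k<i)
      where
      z = P (suc k)
      z-sound = P-sound (s≤s z≤n) (≤-trans k<i i≤n)
      z-left-of-q = source k (≤-trans 1≤v v≤k) (<-≤-trans k<i i≤n) k∉D
      i<Tz : i < entry T z
      i<Tz = left-of-q-in-row (trans (proj₁ z-left-of-q) (cong rowOf Pk≡q))
        (subst (colOf z <_) (trans (proj₂ z-left-of-q) (cong colOf Pk≡q)) (n<1+n _))
      Tz≡1+k : entry T z ≡ suc k
      Tz≡1+k = trans (sym (entry-T₀≡T (proj₁ z-sound) i<Tz)) (proj₂ z-sound)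

  i<n : i < n
  i<n = <-≤-trans i<j j≤n

  same-column-attacks : ∀ {m} → 1 ≤ m → m ≤ n → m ≢ i → colOf p ≡ colOf (P m) → Attacks p (P m)
  same-column-attacks {m} 1≤m m≤n m≢i col≡ = inj₁ (col≡ , λ row≡ → m≢i (begin
    m               ≡⟨ proj₂ (P-sound 1≤m m≤n) ⟨
    entry T₀ (P m)  ≡⟨ cong (entry T₀) (sym (cong₂ _,_ row≡ col≡)) ⟩
    entry T₀ p      ≡⟨ proj₂ p-sound ⟩
    i               ∎))
    where open ≡-Reasoning

  i∈D₀ : InD T₀ i
  i∈D₀ with col T₀ i ≤? col T₀ (suc i)
  ... | yes i∈D = i∈D
  ... | no i∉D = ⊥-elim (<⇒≱ col-q<col-p (subst (_≤ colOf q) (proj₂ next-left-of-p) (≰⇒> i∉Dₜ)))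
    where
    next-left-of-p = source i 1≤i i<n i∉D
    i∉Dₜ : ¬ colOf q ≤ colOf (P (suc i))
    i∉Dₜ = subst (λ x → ¬ colOf q ≤ colOf x) (pos-fixed (n<1+n i) i<n) (i∉D ∘ descents⊆ i 1≤i i<n)

  -- Along i, …, j-1 a non-descent k never starts in column col p: for k = i this
  -- contradicts descents⊆ and col q < col p, for k > i it would make i attack k.
  col-p≤ : ∀ {k} → i ≤ k → k < j → colOf p ≤ colOf (P k)
  col-p≤ {m} i≤m m<j =
    source-column-bound {U = T₀} source (colOf p) i j 1≤i (m≤n⇒m≤1+n j≤n) ≤-refl leaves-col-p m i≤m m<j
    where
    leaves-col-p : ∀ k → i ≤ k → suc k < j → ¬ InD T₀ k → colOf (P k) ≢ colOf p
    leaves-col-p k i≤k 1+k<j k∉D col≡ with m≤n⇒m<n∨m≡n i≤k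
    ... | inj₂ refl = k∉D i∈D₀
    ... | inj₁ i<k = j-first k i<k k<j (same-column-attacks (≤-trans 1≤i (<⇒≤ i<k))
      (<⇒≤ (<-≤-trans k<j j≤n)) (>⇒≢ i<k) (sym col≡))
      where
      k<j = <-trans (n<1+n k) 1+k<j

  col-p< : ∀ {m} → i < m → m < j → colOf p < colOf (P m)
  col-p< {m} i<m m<j = ≤∧≢⇒< (col-p≤ (<⇒≤ i<m) m<j) λ col≡ →
    j-first m i<m m<j (same-column-attacks (≤-trans 1≤i (<⇒≤ i<m)) (<⇒≤ (<-≤-trans m<j j≤n)) (>⇒≢ i<m) col≡)

  col-p≤col-Pj : colOf p ≤ colOf (P j)
  col-p≤col-Pj = Attacks⇒col≤ i-attacks-j

  Pj-not-below-p : ∀ {c} → colOf p ≡ suc c → colOf (P j) ≡ suc c → ¬ rowOf p < rowOf (P j)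
  Pj-not-below-p {c} colp≡ colPj≡ p-above = <-asym i<j (subst₂ _<_ Tb≡j Tr≡i (proj₂ triple-rule))
    where
    r = rowOf p
    b = rowOf (P j)
    p≡ : p ≡ (r , suc c)
    p≡ = cong (r ,_) colp≡
    Pj≡ : P j ≡ (b , suc c)
    Pj≡ = cong (b ,_) colPj≡
    Sr : InShape α r (suc c)
    Sr = subst (InDiagram α) p≡ (proj₁ p-sound)
    Tr≡i : ent T₀ r (suc c) ≡ i
    Tr≡i = subst (λ x → entry T₀ x ≡ i) p≡ (proj₂ p-sound)
    Pj-sound = P-sound (≤-trans 1≤i (<⇒≤ i<j)) j≤n
    Sb : InShape α b (suc c)
    Sb = subst (InDiagram α) Pj≡ (proj₁ Pj-sound)
    Tb≡j : ent T₀ b (suc c) ≡ j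
    Tb≡j = subst (λ x → entry T₀ x ≡ j) Pj≡ (proj₂ Pj-sound)
    Sy : InShape α r c
    Sy = ≤-<-trans (n≤1+n c) Sr
    y = ent T₀ r c
    Py≡ : P y ≡ (r , c)
    Py≡ = SCT₀.pos-entry Sy
    i<y : i < y
    i<y = subst (_< y) Tr≡i (SCT₀.row-decreasing r Sr ≤-refl)
    j<y : ent T₀ b (suc c) < y
    j<y with <-cmp y j
    ... | tri< y<j _ _ = ⊥-elim (1+n≰n (subst₂ _≤_ colp≡ (cong colOf Py≡) (col-p≤ (<⇒≤ i<y) y<j)))
    ... | tri≈ _ refl _ = ⊥-elim (1+n≢n (trans (sym colPj≡) (cong colOf Py≡)))
    ... | tri> _ _ j<y′ = subst (_< y) (sym Tb≡j) j<y′
    triple-rule = IsSCT.triple S₀ r b c p-above Sb Sy j<y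

  p-not-right-below-q : colOf p ≡ suc (colOf q) → ¬ rowOf q < rowOf p
  p-not-right-below-q colp≡ q-above = <-asym Tp<Tz Tz<Tp
    where
    r′ = rowOf q
    c₀ = colOf q
    r = rowOf p
    p≡ : p ≡ (r , suc c₀)
    p≡ = cong (r ,_) colp≡
    Sp : InShape α r (suc c₀)
    Sp = subst (InDiagram α) p≡ (proj₁ p-sound)
    triple-rule = IsSCT.triple S r′ r c₀ q-above Sp (proj₁ q-sound)
      (subst₂ _<_ (cong (entry T) p≡) (sym (proj₂ q-sound)) Tp<i)
    z : Cell
    z = (r′ , suc c₀)
    Tp<Tz : entry T p < entry T z
    Tp<Tz = subst (_< entry T z) (cong (entry T) (sym p≡)) (proj₂ triple-rule)
    Tz<i : entry T z < i
    Tz<i = right-of-q-in-row (proj₁ triple-rule) refl ≤-refl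
    Tz<Tp : entry T z < entry T p
    Tz<Tp = below-p-in-T (proj₁ triple-rule) (sym colp≡) (λ z≡p → <-irrefl (cong rowOf z≡p) q-above)
      (small-T⇒T₀ (proj₁ triple-rule) (<⇒≤ Tz<i))

  col-p≡ : suc (colOf q) ≡ colOf (P j) → colOf p ≡ suc (colOf q)
  col-p≡ 1+col≡ = ≤-antisym (subst (colOf p ≤_) (sym 1+col≡) col-p≤col-Pj) col-q<col-p

  Pj-not-right-below-q : suc (colOf q) ≡ colOf (P j) → ¬ rowOf q < rowOf (P j)
  Pj-not-right-below-q 1+col≡ q-above with <-cmp (rowOf p) (rowOf (P j))
  ... | tri< p-above _ _ = Pj-not-below-p (col-p≡ 1+col≡) (sym 1+col≡) p-above
  ... | tri≈ _ row≡ _ = Attacks-sameColumn⇒row≢ i-attacks-j (trans (col-p≡ 1+col≡) 1+col≡) row≡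
  ... | tri> _ _ Pj-above = p-not-right-below-q (col-p≡ 1+col≡) (<-trans q-above Pj-above)

  col-q< : ∀ {m} → i < m → m ≤ j → colOf q < colOf (P m)
  col-q< {m} i<m m≤j with m≤n⇒m<n∨m≡n m≤j
  ... | inj₂ refl = <-≤-trans col-q<col-p col-p≤col-Pj
  ... | inj₁ m<j = <-trans col-q<col-p (col-p< i<m m<j)

  right-of-q⇒above-q : ∀ {m} → i < m → m ≤ j → suc (colOf q) ≡ colOf (P m) → rowOf (P m) < rowOf q
  right-of-q⇒above-q {m} i<m m≤j 1+col≡ with m≤n⇒m<n∨m≡n m≤j
  ... | inj₁ m<j = ⊥-elim (<-irrefl 1+col≡ (≤-<-trans col-q<col-p (col-p< i<m m<j)))
  ... | inj₂ refl with <-cmp (rowOf (P j)) (rowOf q)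
  ...   | tri< Pj-above _ _ = Pj-above
  ...   | tri> _ _ q-above = ⊥-elim (Pj-not-right-below-q 1+col≡ q-above)
  ...   | tri≈ _ row≡ _ = ⊥-elim (<-asym i<j (subst (_< i) (proj₂ Tj-sound)
            (right-of-q-in-row (proj₁ Tj-sound) (trans (cong rowOf Tj-at-Pj) row≡)
              (subst (colOf q <_) (trans 1+col≡ (cong colOf (sym Tj-at-Pj))) ≤-refl))))
    where
    Tj-sound = SCTₜ.pos-sound (≤-trans 1≤i (<⇒≤ i<j)) j≤n
    Tj-at-Pj = pos-fixed i<j j≤n

  q-attacks-none : ∀ {m} → i < m → m ≤ j → ¬ Attacks q (P m)
  q-attacks-none i<m m≤j (inj₁ (col≡ , _)) = <-irrefl col≡ (col-q< i<m m≤j)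
  q-attacks-none i<m m≤j (inj₂ (1+col≡ , q-above)) = <-asym q-above (right-of-q⇒above-q i<m m≤j 1+col≡)

  open Cycle i<j

  π-T₀-vanishes : piWord (cycWord i j) (just T₀) ≡ nothing
  π-T₀-vanishes = begin
    piWord (cycWord i j) (just T₀)              ≡⟨ cong (λ w → piWord w (just T₀)) cycWord≡ascending ⟩
    piWord (ascending i (j ∸ i)) (just T₀)      ≡⟨ cong (λ e → piWord (ascending i e) (just T₀)) (+-∸-assoc 1 i<j) ⟩
    piWord (ascending i (suc d)) (just T₀)      ≡⟨ piWord-ascending-vanishes T₀ i d moves-freely
                                                     (subst (λ k → col T₀ i ≤ col T₀ k) (sym 1+i+d≡j) col-p≤col-Pj)
                                                     (subst (AttacksIn T₀ i) (sym 1+i+d≡j) i-attacks-j) ⟩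
    nothing                                     ∎
    where
    open ≡-Reasoning
    d = j ∸ suc i
    1+i+d≡j : suc (i + d) ≡ j
    1+i+d≡j = m+[n∸m]≡n i<j
    moves-freely : MovesFreely T₀ i d
    moves-freely m i<m m≤i+d = col-p≤ (<⇒≤ i<m) m<j , j-first m i<m m<j
      where
      m<j : m < j
      m<j = <-≤-trans (s≤s m≤i+d) (≤-reflexive 1+i+d≡j)

  T′ : Tableau
  T′ = map (map σ) T

  π-T≡T′ : piWord (cycWord i j) (just T) ≡ just T′
  π-T≡T′ = begin
    piWord (cycWord i j) (just T)
      ≡⟨ cong (λ w → piWord w (just T)) cycWord≡ascending ⟩
    piWord (ascending i (j ∸ i)) (just T)
      ≡⟨ piWord-ascending-moves T i (j ∸ i) moves-freely ⟩
    just (map (map (applyWord (ascending i (j ∸ i)))) T)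
      ≡⟨ cong (λ w → just (map (map (applyWord w)) T)) cycWord≡ascending ⟨
    just T′
      ∎
    where
    open ≡-Reasoning
    moves-freely : MovesFreely T i (j ∸ i)
    moves-freely m i<m m≤ =
      subst (λ x → colOf q ≤ colOf x × ¬ Attacks q x) (sym (pos-fixed i<m (≤-trans m≤j j≤n)))
        (<⇒≤ (col-q< i<m m≤j) , q-attacks-none i<m m≤j)
      where
      m≤j : m ≤ j
      m≤j = ≤-trans m≤ (≤-reflexive (m+[n∸m]≡n (<⇒≤ i<j)))

  entry-T′ : ∀ x → entry T′ x ≡ σ (entry T x)
  entry-T′ (r , c) = ent-map σ (σ-below 1≤i) T r c

  i-left-of-block : ∀ {x y} → InDiagram α x → InDiagram α y →
    entry T x ≡ i → i < entry T y → entry T y ≤ j → colOf x < colOf y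
  i-left-of-block sx sy x↦i i< ≤j =
    subst₂ _<_ (cong colOf (sym (cell≡q sx x↦i))) (cong colOf (P-entry-T sy i<))
      (col-q< i< ≤j)

  block-right-neighbour-above : ∀ {x y} → InDiagram α x → InDiagram α y →
    entry T x ≡ i → i < entry T y → entry T y ≤ j → suc (colOf x) ≡ colOf y → rowOf y < rowOf x
  block-right-neighbour-above sx sy x↦i i< ≤j 1+col≡ =
    subst₂ _<_ (cong rowOf Py≡y) (cong rowOf (sym x≡q))
      (right-of-q⇒above-q i< ≤j (trans (cong (suc ∘ colOf) (sym x≡q)) (trans 1+col≡ (cong colOf (sym Py≡y)))))
    where
    x≡q = cell≡q sx x↦i
    Py≡y = P-entry-T sy i<

  no-flip-in-column : ∀ {x y} → InDiagram α x → InDiagram α y → colOf x ≡ colOf y →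
    ¬ Flip (entry T x) (entry T y)
  no-flip-in-column sx sy col≡ (x↦i , i< , ≤j) = <-irrefl col≡ (i-left-of-block sx sy x↦i i< ≤j)

  T′-order : ∀ {x y} → ¬ Flip (entry T x) (entry T y) → ¬ Flip (entry T y) (entry T x) →
    entry T x < entry T y ⇔ entry T′ x < entry T′ y
  T′-order {x} {y} ¬xy ¬yx = subst₂ (λ a b → entry T x < entry T y ⇔ a < b) (sym (entry-T′ x)) (sym (entry-T′ y))
    (σ-<-⇔ ¬xy ¬yx)

  T′-column-order : ∀ {x y} → InDiagram α x → InDiagram α y → colOf x ≡ colOf y →
    entry T x < entry T y ⇔ entry T′ x < entry T′ y
  T′-column-order sx sy col≡ = T′-order (no-flip-in-column sx sy col≡) (no-flip-in-column sy sx (sym col≡))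

  T′-bij : concat T′ ↭ map suc (upTo n)
  T′-bij = begin
    concat (map (map σ) T)        ≡⟨ concat-map T ⟩
    map σ (concat T)              ↭⟨ ↭.map⁺ σ (IsSCT.bij S) ⟩
    map σ (map suc (upTo n))      ↭⟨ map-applyWord-↭ (cycWord i j) (Unique-range n) letters-in-range ⟩
    map suc (upTo n)              ∎
    where
    open PermutationReasoning
    letters-in-range : All (λ a → ∀ {x} → x ∈ map suc (upTo n) → swapEntry a x ∈ map suc (upTo n))
      (cycWord i j)
    letters-in-range = subst (All _) (sym cycWord≡ascending) (All-ascending i (j ∸ i) λ k i≤k k< →
      swapEntry-∈-range (≤-trans 1≤i i≤k)
        (≤-trans (<-≤-trans k< (≤-reflexive (m+[n∸m]≡n (<⇒≤ i<j)))) j≤n))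

  T′-rowDec : ∀ r c → InShape α r (suc c) → ent T′ r (suc c) < ent T′ r c
  T′-rowDec r c s = to (T′-order ¬xy ¬yx) (IsSCT.rowDec S r c s)
    where
    s′ = ≤-<-trans (n≤1+n c) s
    ¬xy : ¬ Flip (ent T r (suc c)) (ent T r c)
    ¬xy (x↦i , i< , ≤j) = <-asym (i-left-of-block {r , suc c} {r , c} s s′ x↦i i< ≤j) (n<1+n c)
    ¬yx : ¬ Flip (ent T r c) (ent T r (suc c))
    ¬yx (y↦i , i< , ≤j) = <-irrefl refl (block-right-neighbour-above {r , c} {r , suc c} s′ s y↦i i< ≤j refl)

  T′-col1Inc : All (0 <_) α → ∀ r → suc r < length α → ent T′ r 0 < ent T′ (suc r) 0
  T′-col1Inc 0<α r r+1< = to (T′-column-order {r , 0} {suc r , 0}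
    (InShape-first r 0<α (<-trans (n<1+n r) r+1<)) (InShape-first (suc r) 0<α r+1<) refl)
    (IsSCT.col1Inc S r r+1<)

  T′-triple : ∀ a b k → a < b → InShape α b (suc k) → InShape α a k →
    ent T′ b (suc k) < ent T′ a k →
    InShape α a (suc k) × ent T′ b (suc k) < ent T′ a (suc k)
  T′-triple a b k a<b sX sY T′X<T′Y = sZ , to (T′-column-order {b , suc k} {a , suc k} sX sZ refl) TX<TZ
    where
    ¬XY : ¬ Flip (ent T b (suc k)) (ent T a k)
    ¬XY (X↦i , i< , ≤j) = <-asym (i-left-of-block {b , suc k} {a , k} sX sY X↦i i< ≤j) (n<1+n k)
    ¬YX : ¬ Flip (ent T a k) (ent T b (suc k))
    ¬YX (Y↦i , i< , ≤j) = <-asym a<b (block-right-neighbour-above {a , k} {b , suc k} sY sX Y↦i i< ≤j refl)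
    triple-rule = IsSCT.triple S a b k a<b sX sY (from (T′-order ¬XY ¬YX) T′X<T′Y)
    sZ = proj₁ triple-rule
    TX<TZ = proj₂ triple-rule

  T′-isSCT : All (0 <_) α → IsSCT n α T′
  T′-isSCT 0<α = record
    { shape = trans (shape-map σ T) (IsSCT.shape S)
    ; bij = T′-bij
    ; rowDec = T′-rowDec
    ; col1Inc = T′-col1Inc 0<α
    ; triple = T′-triple
    }

  T′-equiv : Equiv α T′ T₀
  T′-equiv r r′ c sx sy =
    mk⇔ (to (equiv r r′ c sx sy) ∘ from (T′-column-order sx sy refl))
        (to (T′-column-order sx sy refl) ∘ from (equiv r r′ c sx sy))

  colWord-T′ : colWord T′ ≡ map (applyWord (cycWord i j)) (colWord T)
  colWord-T′ = colWord-map σ T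

lemma4p9 : (n : ℕ) (α : List ℕ) → IsComposition n α →
  (T₀ T : Tableau) → IsSCT n α T₀ → IsSource n T₀ →
  IsSCT n α T → Equiv α T T₀ → T ≢ T₀ →
  (∀ k → 1 ≤ k → k < n → InD T k → InD T₀ k) →
  (i : ℕ) → 1 ≤ i → i ≤ n → findPos T i ≢ findPos T₀ i →
  (∀ k → i < k → k ≤ n → findPos T k ≡ findPos T₀ k) →
  (j : ℕ) → i < j → j ≤ n → AttacksIn T₀ i j →
  (∀ k → i < k → k < j → ¬ AttacksIn T₀ i k) →
  (piWord (cycWord i j) (just T₀) ≡ nothing)
  × ∃ (λ T' → piWord (cycWord i j) (just T) ≡ just T'
              × IsSCT n α T' × Equiv α T' T₀
              × colWord T' ≡ map (applyWord (cycWord i j)) (colWord T))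
lemma4p9 n α (0<α , _) T₀ T S₀ source S equiv _ descents⊆
         i 1≤i i≤n i-moved above-i-fixed j i<j j≤n i-attacks-j j-first =
  π-T₀-vanishes , T′ , π-T≡T′ , T′-isSCT 0<α , T′-equiv , colWord-T′
  where
  open Lemma49 S₀ source S equiv descents⊆ 1≤i i≤n i-moved above-i-fixed i<j j≤n i-attacks-j j-first
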